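{- Let $k\geq 1$ and $0\leq \alpha\leq k$ be integers. If $A$ is a set of $k$ positive integers, then \[|\Sigma_{\alpha}(A)|\geq \frac{k(k+1)}{2}-\frac{\alpha(\alpha+1)}{2}+1.\] Moreover, this lower bound is best possible, i.e., it is attained by some set of $k$ positive integers.
   Context: For a finite set $A$ of integers with $|A|=k$ and an integer $0\leq\alpha\leq k$, $\Sigma_{\alpha}(A)=\{s(B): B\subseteq A,\ |B|\geq \alpha\}$, where $s(B)=\sum_{b\in B} b$ and $s(\emptyset)=0$. -}

module Defs where

open import Data.Nat using (ℕ; zero; suc; _+_; _≤?_; _≟_)
open import Data.Bool using (Bool; true; false)
open import Data.Vec using (Vec; []; _∷_)
open import Data.List using (List; []; _∷_; map; filter; length; deduplicate; _++_)
open import Data.Fin.Subset using (Subset; ∣_∣)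

allSubsets : (k : ℕ) → List (Subset k)
allSubsets zero = [] ∷ []
allSubsets (suc k) = map (true ∷_) (allSubsets k) ++ map (false ∷_) (allSubsets k)

subsetSum : {k : ℕ} → Vec ℕ k → Subset k → ℕ
subsetSum [] [] = 0
subsetSum (a ∷ A) (true ∷ B) = a + subsetSum A B
subsetSum (a ∷ A) (false ∷ B) = subsetSum A B

-- Σ_α(A) as a list (with repetitions) of s(B) over all B with |B| ≥ α
sigmaList : {k : ℕ} → ℕ → Vec ℕ k → List ℕ
sigmaList {k} α A = map (subsetSum A) (filter (λ B → α ≤? ∣ B ∣) (allSubsets k))

cardSigma : {k : ℕ} → ℕ → Vec ℕ k → ℕ
cardSigma α A = length (deduplicate _≟_ (sigmaList α A))

module Submission where

-- Lower bound, by induction on k.  If α = k, then Σ_α(A) contains s(A).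
-- If α < k, let a be the largest element of A and A' = A ∖ {a}, with total
-- sum S'.  The k numbers a + S' and a + S' - x (x ∈ A') are pairwise
-- distinct, exceed S', and are sums of at least k - 1 ≥ α elements of A;
-- every element of Σ_α(A') is at most S' and lies in Σ_α(A).  Hence
-- |Σ_α(A)| ≥ k + |Σ_α(A')|, and T(k) = k + T(k-1) closes the induction.
--
-- Sharpness: for A = {k, k-1, ..., 1} a subset B with |B| ≥ α has
-- T(α) ≤ T(|B|) ≤ s(B) ≤ T(k), so Σ_α(A) lies in an interval of
-- T(k) - T(α) + 1 integers.

open import Defs
open import Data.Nat using (ℕ; zero; suc; _+_; _*_; _∸_; _≤_; _<_; _≥_; z≤n; s≤s; _≤?_; _≟_)
open import Data.Nat.Properties
open import Data.Nat.Tactic.RingSolver using (solve-∀)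
open import Algebra.Properties.CommutativeSemigroup +-commutativeSemigroup using (x∙yz≈y∙xz; xy∙z≈xz∙y)
open import Data.Bool using (Bool; true; false)
open import Data.Vec using (Vec; []; _∷_; lookup; insertAt; removeAt)
open import Data.Vec.Properties using (insertAt-punchIn; insertAt-removeAt)
open import Data.Fin using (Fin; punchIn) renaming (zero to fzero; suc to fsuc)
open import Data.Fin.Properties using (punchIn-injective; punchInᵢ≢i)
open import Data.Fin.Subset using (Subset; ∣_∣)
open import Data.List using (List; []; _∷_; map; length; deduplicate; _++_; tabulate; applyUpTo)
open import Data.List.Properties using (length-++; length-tabulate; length-applyUpTo)
open import Data.List.Membership.Propositional using (_∈_)
open import Data.List.Membership.Propositional.Properties
open import Data.List.Relation.Unary.Any using (here; there)
open import Data.List.Relation.Unary.All as All using (All; []; _∷_)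
import Data.List.Relation.Unary.All.Properties as AllP
open import Data.List.Relation.Unary.AllPairs using ([]; _∷_)
open import Data.List.Relation.Unary.Unique.Propositional using (Unique)
import Data.List.Relation.Unary.Unique.Propositional.Properties as UniqueP
open import Data.List.Relation.Unary.Unique.DecPropositional.Properties _≟_ using (deduplicate-!)
open import Data.Product using (_×_; ∃; _,_; proj₁; proj₂)
open import Data.Sum using (inj₁; inj₂)
open import Data.Empty using (⊥)
open import Relation.Nullary using (yes; no; contradiction)
open import Relation.Binary.PropositionalEquality
  using (_≡_; _≢_; refl; sym; trans; cong; cong₂; subst; subst₂; module ≡-Reasoning)

unique-⊆-length : ∀ {A : Set} {L M : List A} → Unique L →
  (∀ {x} → x ∈ L → x ∈ M) → length L ≤ length M
unique-⊆-length {L = []} _ _ = z≤n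
unique-⊆-length {L = x ∷ L} {M} (x∉L ∷ uniqueL) L⊆M
  with ys , zs , M≡ ← ∈-∃++ (L⊆M (here refl)) =
  subst (suc (length L) ≤_) (sym length-M) (s≤s (unique-⊆-length uniqueL L⊆ys++zs))
  where
  length-M : length M ≡ suc (length (ys ++ zs))
  length-M = begin
    length M                      ≡⟨ cong length M≡ ⟩
    length (ys ++ x ∷ zs)         ≡⟨ length-++ ys ⟩
    length ys + suc (length zs)   ≡⟨ +-suc (length ys) (length zs) ⟩
    suc (length ys + length zs)   ≡⟨ cong suc (sym (length-++ ys)) ⟩
    suc (length (ys ++ zs))       ∎
    where open ≡-Reasoning
  -- the elements of L avoid x, so they survive deleting x from M
  L⊆ys++zs : ∀ {y} → y ∈ L → y ∈ ys ++ zs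
  L⊆ys++zs {y} y∈L with ∈-++⁻ ys (subst (y ∈_) M≡ (L⊆M (there y∈L)))
  ... | inj₁ y∈ys         = ∈-++⁺ˡ y∈ys
  ... | inj₂ (here y≡x)   = contradiction (sym y≡x) (All.lookup x∉L y∈L)
  ... | inj₂ (there y∈zs) = ∈-++⁺ʳ ys y∈zs

IsSum : ∀ {n} → ℕ → Vec ℕ n → ℕ → Set
IsSum {n} α A x = ∃ λ (B : Subset n) → α ≤ ∣ B ∣ × x ≡ subsetSum A B

allSubsets-complete : ∀ {n} (B : Subset n) → B ∈ allSubsets n
allSubsets-complete [] = here refl
allSubsets-complete {suc n} (true ∷ B) =
  ∈-++⁺ˡ (∈-map⁺ (true ∷_) (allSubsets-complete B))
allSubsets-complete {suc n} (false ∷ B) =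
  ∈-++⁺ʳ (map (true ∷_) (allSubsets n)) (∈-map⁺ (false ∷_) (allSubsets-complete B))

sigmaList-complete : ∀ {n α} (A : Vec ℕ n) {x} → IsSum α A x → x ∈ sigmaList α A
sigmaList-complete {α = α} A (B , α≤∣B∣ , x≡) =
  ∈-map∘filter⁺ (subsetSum A) (λ B → α ≤? ∣ B ∣) (B , allSubsets-complete B , x≡ , α≤∣B∣)

sigmaList-sound : ∀ {n α} (A : Vec ℕ n) {x} → x ∈ sigmaList α A → IsSum α A x
sigmaList-sound {n} {α} A x∈
  with B , _ , x≡ , α≤∣B∣ ← ∈-map∘filter⁻ (subsetSum A) (λ B → α ≤? ∣ B ∣) {xs = allSubsets n} x∈ =
  B , α≤∣B∣ , x≡

record SumFamily (α : ℕ) {n : ℕ} (A : Vec ℕ n) (c : ℕ) : Set where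
  field
    sums   : List ℕ
    unique : Unique sums
    valid  : All (IsSum α A) sums
    size   : length sums ≡ c

cardSigma-≥ : ∀ {n α c} {A : Vec ℕ n} → SumFamily α A c → c ≤ cardSigma α A
cardSigma-≥ {A = A} F = subst (_≤ _) size (unique-⊆-length unique
  (λ x∈ → ∈-deduplicate⁺ _≟_ (sigmaList-complete A (All.lookup valid x∈))))
  where open SumFamily F

cardSigma-≤ : ∀ {n α} (A : Vec ℕ n) (M : List ℕ) →
  (∀ {x} → IsSum α A x → x ∈ M) → cardSigma α A ≤ length M
cardSigma-≤ {α = α} A M Σ⊆M = unique-⊆-length (deduplicate-! (sigmaList α A))
  (λ x∈ → Σ⊆M (sigmaList-sound A (∈-deduplicate⁻ _≟_ (sigmaList α A) x∈)))

IsSum-weaken : ∀ {n α β} {A : Vec ℕ n} {x} → α ≤ β → IsSum β A x → IsSum α A x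
IsSum-weaken α≤β (B , β≤∣B∣ , x≡) = B , ≤-trans α≤β β≤∣B∣ , x≡

card-≤ : ∀ {n} (B : Subset n) → ∣ B ∣ ≤ n
card-≤ [] = z≤n
card-≤ (true ∷ B) = s≤s (card-≤ B)
card-≤ (false ∷ B) = m≤n⇒m≤1+n (card-≤ B)

full : ∀ n → Subset n
full zero = []
full (suc n) = true ∷ full n

card-full : ∀ n → ∣ full n ∣ ≡ n
card-full zero = refl
card-full (suc n) = cong suc (card-full n)

except : ∀ {n} → Fin n → Subset n
except {suc n} fzero = false ∷ full n
except (fsuc j) = true ∷ except j

card-except : ∀ {n} (j : Fin n) → suc ∣ except j ∣ ≡ n
card-except {suc n} fzero = cong suc (card-full n)
card-except (fsuc j) = cong suc (card-except j)

total : ∀ {n} → Vec ℕ n → ℕ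
total {n} A = subsetSum A (full n)

subsetSum-except : ∀ {n} (A : Vec ℕ n) (j : Fin n) →
  subsetSum A (except j) + lookup A j ≡ total A
subsetSum-except (a ∷ A) fzero = +-comm (total A) a
subsetSum-except (a ∷ A) (fsuc j) = trans (+-assoc a _ _) (cong (a +_) (subsetSum-except A j))

subsetSum-≤-total : ∀ {n} (A : Vec ℕ n) (B : Subset n) → subsetSum A B ≤ total A
subsetSum-≤-total [] [] = z≤n
subsetSum-≤-total (a ∷ A) (true ∷ B) = +-monoʳ-≤ a (subsetSum-≤-total A B)
subsetSum-≤-total (a ∷ A) (false ∷ B) = ≤-trans (subsetSum-≤-total A B) (m≤n+m _ a)

weight : Bool → ℕ → ℕ
weight true a = a
weight false a = 0

subsetSum-insertAt : ∀ {n} (A : Vec ℕ (suc n)) (i : Fin (suc n)) (B : Subset n) (b : Bool) →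
  subsetSum A (insertAt B i b) ≡ weight b (lookup A i) + subsetSum (removeAt A i) B
subsetSum-insertAt (a ∷ A) fzero B true = refl
subsetSum-insertAt (a ∷ A) fzero B false = refl
subsetSum-insertAt (a ∷ x ∷ A) (fsuc i) (false ∷ B) b = subsetSum-insertAt (x ∷ A) i B b
subsetSum-insertAt (a ∷ x ∷ A) (fsuc i) (true ∷ B) b = begin
  a + subsetSum (x ∷ A) (insertAt B i b)    ≡⟨ cong (a +_) (subsetSum-insertAt (x ∷ A) i B b) ⟩
  a + (w + subsetSum (removeAt (x ∷ A) i) B) ≡⟨ x∙yz≈y∙xz a w _ ⟩
  w + (a + subsetSum (removeAt (x ∷ A) i) B) ∎
  where
  open ≡-Reasoning
  w = weight b (lookup (x ∷ A) i)

card-insertAt : ∀ {n} (i : Fin (suc n)) (B : Subset n) (b : Bool) →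
  ∣ insertAt B i b ∣ ≡ weight b 1 + ∣ B ∣
card-insertAt fzero B true = refl
card-insertAt fzero B false = refl
card-insertAt (fsuc i) (false ∷ B) b = card-insertAt i B b
card-insertAt (fsuc i) (true ∷ B) b =
  trans (cong suc (card-insertAt i B b)) (sym (+-suc (weight b 1) ∣ B ∣))

IsSum-skip : ∀ {n α} (A : Vec ℕ (suc n)) (i : Fin (suc n)) {x} →
  IsSum α (removeAt A i) x → IsSum α A x
IsSum-skip {α = α} A i (B , α≤∣B∣ , refl) =
  insertAt B i false ,
  subst (α ≤_) (sym (card-insertAt i B false)) α≤∣B∣ ,
  sym (subsetSum-insertAt A i B false)

IsSum-add : ∀ {n} (A : Vec ℕ (suc n)) (i : Fin (suc n)) (B : Subset n) →
  IsSum (suc ∣ B ∣) A (lookup A i + subsetSum (removeAt A i) B)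
IsSum-add A i B =
  insertAt B i true ,
  ≤-reflexive (sym (card-insertAt i B true)) ,
  sym (subsetSum-insertAt A i B true)

-- A vector encodes a set of positive integers when its entries are
-- positive and pairwise distinct.
Positive : ∀ {n} → Vec ℕ n → Set
Positive A = ∀ i → 0 < lookup A i

Distinct : ∀ {n} → Vec ℕ n → Set
Distinct A = ∀ i j → lookup A i ≡ lookup A j → i ≡ j

IsMax : ∀ {n} → Vec ℕ n → Fin n → Set
IsMax A i = ∀ j → lookup A j ≤ lookup A i

maxIndex : ∀ {n} (A : Vec ℕ (suc n)) → ∃ (IsMax A)
maxIndex (a ∷ []) = fzero , λ { fzero → ≤-refl }
maxIndex (a ∷ x ∷ A) with maxIndex (x ∷ A)
... | i , max with a ≤? lookup (x ∷ A) i
...   | yes a≤ = fsuc i , λ { fzero → a≤ ; (fsuc j) → max j }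
...   | no a≰ = fzero , λ { fzero → ≤-refl ; (fsuc j) → ≤-trans (max j) (<⇒≤ (≰⇒> a≰)) }

lookup-removeAt : ∀ {n} (A : Vec ℕ (suc n)) (i : Fin (suc n)) (j : Fin n) →
  lookup (removeAt A i) j ≡ lookup A (punchIn i j)
lookup-removeAt A i j = begin
  lookup (removeAt A i) j
    ≡⟨ sym (insertAt-punchIn (removeAt A i) i (lookup A i) j) ⟩
  lookup (insertAt (removeAt A i) i (lookup A i)) (punchIn i j)
    ≡⟨ cong (λ v → lookup v (punchIn i j)) (insertAt-removeAt A i) ⟩
  lookup A (punchIn i j) ∎
  where open ≡-Reasoning

removeAt-positive : ∀ {n} (A : Vec ℕ (suc n)) (i : Fin (suc n)) →
  Positive A → Positive (removeAt A i)
removeAt-positive A i pos j = subst (0 <_) (sym (lookup-removeAt A i j)) (pos (punchIn i j))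

removeAt-distinct : ∀ {n} (A : Vec ℕ (suc n)) (i : Fin (suc n)) →
  Distinct A → Distinct (removeAt A i)
removeAt-distinct A i dist j j′ eq = punchIn-injective i j j′
  (dist _ _ (trans (sym (lookup-removeAt A i j)) (trans eq (lookup-removeAt A i j′))))

removeAt-below-max : ∀ {n} (A : Vec ℕ (suc n)) (i : Fin (suc n)) → Distinct A → IsMax A i →
  ∀ j → lookup (removeAt A i) j < lookup A i
removeAt-below-max A i dist max j = subst (_< lookup A i) (sym (lookup-removeAt A i j))
  (≤∧≢⇒< (max (punchIn i j)) (λ eq → punchInᵢ≢i i j (dist _ _ eq)))

-- The sums contributed by a new largest element a on top of A′:
-- a + s(A′) and a + s(A′) - A′[j] = a + s(A′ minus j) for each j.
topSums : ∀ {m} → ℕ → Vec ℕ m → List ℕ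
topSums a A′ = (a + total A′) ∷ tabulate (λ j → a + subsetSum A′ (except j))

topSums-length : ∀ {m} (a : ℕ) (A′ : Vec ℕ m) → length (topSums a A′) ≡ suc m
topSums-length a A′ = cong suc (length-tabulate _)

-- They are pairwise distinct: dropping different entries of a set of
-- distinct numbers gives different sums, and dropping a positive entry
-- gives less than the total.
topSums-unique : ∀ {m} (a : ℕ) (A′ : Vec ℕ m) → Positive A′ → Distinct A′ →
  Unique (topSums a A′)
topSums-unique a A′ pos dist = AllP.tabulate⁺ top≢drop ∷ UniqueP.tabulate⁺ drop-injective
  where
  drop<total : ∀ j → subsetSum A′ (except j) < total A′
  drop<total j = subst (subsetSum A′ (except j) <_) (subsetSum-except A′ j) (m<m+n _ (pos j))

  top≢drop : ∀ j → a + total A′ ≢ a + subsetSum A′ (except j)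
  top≢drop j eq = <-irrefl (sym (+-cancelˡ-≡ a _ _ eq)) (drop<total j)

  drop-injective : ∀ {j j′} → a + subsetSum A′ (except j) ≡ a + subsetSum A′ (except j′) → j ≡ j′
  drop-injective {j} {j′} eq = dist j j′ (+-cancelˡ-≡ (subsetSum A′ (except j)) _ _ (begin
    subsetSum A′ (except j) + lookup A′ j   ≡⟨ subsetSum-except A′ j ⟩
    total A′                                ≡⟨ sym (subsetSum-except A′ j′) ⟩
    subsetSum A′ (except j′) + lookup A′ j′ ≡⟨ cong (_+ lookup A′ j′) (sym (+-cancelˡ-≡ a _ _ eq)) ⟩
    subsetSum A′ (except j) + lookup A′ j′  ∎))
    where open ≡-Reasoning

topSums-above : ∀ {m} (a : ℕ) (A′ : Vec ℕ m) → 0 < a → (∀ j → lookup A′ j < a) →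
  All (total A′ <_) (topSums a A′)
topSums-above a A′ 0<a below = top>total ∷ AllP.tabulate⁺ drop>total
  where
  top>total : total A′ < a + total A′
  top>total = subst (total A′ <_) (+-comm (total A′) a) (m<m+n (total A′) 0<a)

  drop>total : ∀ j → total A′ < a + subsetSum A′ (except j)
  drop>total j = subst₂ _<_ (subsetSum-except A′ j) (+-comm _ a)
    (+-monoʳ-< (subsetSum A′ (except j)) (below j))

-- When a = A[i] and A′ = A with A[i] removed, they are sums of at least
-- m elements of A, hence lie in Σ_α(A) for α ≤ m.
topSums-valid : ∀ {m α} (A : Vec ℕ (suc m)) (i : Fin (suc m)) → α ≤ m →
  All (IsSum α A) (topSums (lookup A i) (removeAt A i))
topSums-valid {m} {α} A i α≤m = top ∷ AllP.tabulate⁺ drop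
  where
  top : IsSum α A (lookup A i + total (removeAt A i))
  top = IsSum-weaken {A = A} (m≤n⇒m≤1+n (subst (_ ≤_) (sym (card-full m)) α≤m)) (IsSum-add A i (full m))

  drop : ∀ j → IsSum α A (lookup A i + subsetSum (removeAt A i) (except j))
  drop j = IsSum-weaken {A = A} (subst (_ ≤_) (sym (card-except j)) α≤m) (IsSum-add A i (except j))

extendFamily : ∀ {m α c} (A : Vec ℕ (suc m)) (i : Fin (suc m)) →
  Positive A → Distinct A → IsMax A i → α ≤ m →
  SumFamily α (removeAt A i) c → SumFamily α A (suc m + c)
extendFamily {m} A i pos dist max α≤m F = record
  { sums   = new ++ F.sums
  ; unique = UniqueP.++⁺ new-unique F.unique separated
  ; valid  = AllP.++⁺ (topSums-valid A i α≤m) (All.map (IsSum-skip A i) F.valid)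
  ; size   = trans (length-++ new) (cong₂ _+_ (topSums-length a A′) F.size)
  }
  where
  module F = SumFamily F
  a : ℕ
  a = lookup A i
  A′ : Vec ℕ m
  A′ = removeAt A i
  new : List ℕ
  new = topSums a A′

  new-unique : Unique new
  new-unique = topSums-unique a A′ (removeAt-positive A i pos) (removeAt-distinct A i dist)

  new-above : All (total A′ <_) new
  new-above = topSums-above a A′ (pos i) (removeAt-below-max A i dist max)

  old-below : All (_≤ total A′) F.sums
  old-below = All.map (λ { (B , _ , refl) → subsetSum-≤-total A′ B }) F.valid

  separated : ∀ {x} → x ∈ new × x ∈ F.sums → ⊥
  separated (x∈new , x∈old) = <⇒≱ (All.lookup new-above x∈new) (All.lookup old-below x∈old)

tri : ℕ → ℕ
tri zero = 0
tri (suc n) = tri n + suc n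

tri-mono : ∀ {m n} → m ≤ n → tri m ≤ tri n
tri-mono {zero} _ = z≤n
tri-mono {suc m} {suc n} (s≤s m≤n) = +-mono-≤ (tri-mono m≤n) (s≤s m≤n)

double-tri : ∀ n → 2 * tri n ≡ n * (n + 1)
double-tri zero = refl
double-tri (suc n) = begin
  2 * (tri n + suc n)         ≡⟨ *-distribˡ-+ 2 (tri n) (suc n) ⟩
  2 * tri n + 2 * suc n       ≡⟨ cong (_+ 2 * suc n) (double-tri n) ⟩
  n * (n + 1) + 2 * suc n     ≡⟨ step n ⟩
  suc n * (suc n + 1)         ∎
  where
  open ≡-Reasoning
  step : ∀ n → n * (n + 1) + 2 * suc n ≡ suc n * (suc n + 1)
  step = solve-∀

bound-tri : ∀ k α → k * (k + 1) ∸ α * (α + 1) + 2 ≡ 2 * (tri k ∸ tri α + 1)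
bound-tri k α = begin
  k * (k + 1) ∸ α * (α + 1) + 2     ≡⟨ cong₂ (λ x y → x ∸ y + 2) (sym (double-tri k)) (sym (double-tri α)) ⟩
  2 * tri k ∸ 2 * tri α + 2         ≡⟨ cong (_+ 2) (sym (*-distribˡ-∸ 2 (tri k) (tri α))) ⟩
  2 * (tri k ∸ tri α) + 2           ≡⟨ sym (*-distribˡ-+ 2 (tri k ∸ tri α) 1) ⟩
  2 * (tri k ∸ tri α + 1)           ∎
  where open ≡-Reasoning

tri-∸-step : ∀ {m α} → α ≤ m → suc m + (tri m ∸ tri α + 1) ≡ tri (suc m) ∸ tri α + 1
tri-∸-step {m} {α} α≤m = begin
  suc m + (tri m ∸ tri α + 1)   ≡⟨ +-comm (suc m) _ ⟩
  (tri m ∸ tri α + 1) + suc m   ≡⟨ xy∙z≈xz∙y (tri m ∸ tri α) 1 (suc m) ⟩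
  (tri m ∸ tri α + suc m) + 1   ≡⟨ cong (_+ 1) (sym (+-∸-comm (suc m) (tri-mono α≤m))) ⟩
  (tri m + suc m) ∸ tri α + 1   ∎
  where open ≡-Reasoning

lowerFamily : ∀ n α → α ≤ n → (A : Vec ℕ n) → Positive A → Distinct A →
  SumFamily α A (tri n ∸ tri α + 1)
lowerFamily n α α≤n A pos dist with m≤n⇒m<n∨m≡n α≤n
... | inj₂ refl = record
  { sums   = total A ∷ []
  ; unique = [] ∷ []
  ; valid  = (full n , ≤-reflexive (sym (card-full n)) , refl) ∷ []
  ; size   = cong (_+ 1) (sym (n∸n≡0 (tri n)))
  }
lowerFamily (suc m) α _ A pos dist | inj₁ (s≤s α≤m) =
  subst (SumFamily α A) (tri-∸-step α≤m)
    (extendFamily A i pos dist max α≤m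
      (lowerFamily m α α≤m (removeAt A i) (removeAt-positive A i pos) (removeAt-distinct A i dist)))
  where
  i : Fin (suc m)
  i = proj₁ (maxIndex A)
  max : IsMax A i
  max = proj₂ (maxIndex A)

cardSigma-lower : ∀ k α → α ≤ k → (A : Vec ℕ k) → Positive A → Distinct A →
  tri k ∸ tri α + 1 ≤ cardSigma α A
cardSigma-lower k α α≤k A pos dist = cardSigma-≥ (lowerFamily k α α≤k A pos dist)

distinct-∷ : ∀ {n a} {A : Vec ℕ n} → (∀ j → lookup A j < a) → Distinct A → Distinct (a ∷ A)
distinct-∷ below dist fzero fzero _ = refl
distinct-∷ below dist fzero (fsuc j) eq = contradiction (sym eq) (<⇒≢ (below j))
distinct-∷ below dist (fsuc i) fzero eq = contradiction eq (<⇒≢ (below i))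
distinct-∷ below dist (fsuc i) (fsuc j) eq = cong fsuc (dist i j eq)

descending : ∀ n → Vec ℕ n
descending zero = []
descending (suc n) = suc n ∷ descending n

descending-≤ : ∀ n (j : Fin n) → lookup (descending n) j ≤ n
descending-≤ (suc n) fzero = ≤-refl
descending-≤ (suc n) (fsuc j) = m≤n⇒m≤1+n (descending-≤ n j)

descending-positive : ∀ n → Positive (descending n)
descending-positive (suc n) fzero = s≤s z≤n
descending-positive (suc n) (fsuc j) = descending-positive n j

descending-distinct : ∀ n → Distinct (descending n)
descending-distinct zero = λ ()
descending-distinct (suc n) = distinct-∷ (λ j → s≤s (descending-≤ n j)) (descending-distinct n)

subsetSum-descending-≥ : ∀ n (B : Subset n) → tri ∣ B ∣ ≤ subsetSum (descending n) B
subsetSum-descending-≥ zero [] = z≤n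
subsetSum-descending-≥ (suc n) (false ∷ B) = subsetSum-descending-≥ n B
subsetSum-descending-≥ (suc n) (true ∷ B) = subst (tri ∣ B ∣ + suc ∣ B ∣ ≤_)
  (+-comm (subsetSum (descending n) B) (suc n))
  (+-mono-≤ (subsetSum-descending-≥ n B) (s≤s (card-≤ B)))

total-descending : ∀ n → total (descending n) ≡ tri n
total-descending zero = refl
total-descending (suc n) = trans (cong (suc n +_) (total-descending n)) (+-comm (suc n) (tri n))

interval : ℕ → ℕ → List ℕ
interval lo hi = applyUpTo (lo +_) (suc (hi ∸ lo))

interval-length : ∀ lo hi → length (interval lo hi) ≡ hi ∸ lo + 1
interval-length lo hi = trans (length-applyUpTo (lo +_) (suc (hi ∸ lo))) (+-comm 1 (hi ∸ lo))

interval-complete : ∀ {lo hi x} → lo ≤ x → x ≤ hi → x ∈ interval lo hi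
interval-complete {lo} {hi} lo≤x x≤hi = subst (_∈ interval lo hi) (m+[n∸m]≡n lo≤x)
  (∈-applyUpTo⁺ (lo +_) (s≤s (∸-monoˡ-≤ lo x≤hi)))

descending-upper : ∀ k α → cardSigma α (descending k) ≤ tri k ∸ tri α + 1
descending-upper k α = subst (cardSigma α (descending k) ≤_) (interval-length (tri α) (tri k))
  (cardSigma-≤ (descending k) (interval (tri α) (tri k)) Σ⊆interval)
  where
  Σ⊆interval : ∀ {x} → IsSum α (descending k) x → x ∈ interval (tri α) (tri k)
  Σ⊆interval (B , α≤∣B∣ , refl) = interval-complete
    (≤-trans (tri-mono α≤∣B∣) (subsetSum-descending-≥ k B))
    (subst (subsetSum (descending k) B ≤_) (total-descending k) (subsetSum-≤-total (descending k) B))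

theorem2p1 : (k α : ℕ) → 1 ≤ k → α ≤ k →
    ((A : Vec ℕ k) → (∀ i → 0 < lookup A i) →
      (∀ i j → lookup A i ≡ lookup A j → i ≡ j) →
      2 * cardSigma α A ≥ k * (k + 1) ∸ α * (α + 1) + 2)
    × ∃ (λ (A : Vec ℕ k) → (∀ i → 0 < lookup A i) ×
      (∀ i j → lookup A i ≡ lookup A j → i ≡ j) ×
      (2 * cardSigma α A ≡ k * (k + 1) ∸ α * (α + 1) + 2))
theorem2p1 k α _ α≤k =
  lower-bound , descending k , descending-positive k , descending-distinct k , attained
  where
  lower-bound : (A : Vec ℕ k) → Positive A → Distinct A →
    2 * cardSigma α A ≥ k * (k + 1) ∸ α * (α + 1) + 2
  lower-bound A pos dist = subst (_≤ 2 * cardSigma α A) (sym (bound-tri k α))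
    (*-monoʳ-≤ 2 (cardSigma-lower k α α≤k A pos dist))

  exact : cardSigma α (descending k) ≡ tri k ∸ tri α + 1
  exact = ≤-antisym (descending-upper k α)
    (cardSigma-lower k α α≤k (descending k) (descending-positive k) (descending-distinct k))

  attained : 2 * cardSigma α (descending k) ≡ k * (k + 1) ∸ α * (α + 1) + 2
  attained = trans (cong (2 *_) exact) (sym (bound-tri k α))
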